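{- Let $D$ be a comparability digraph and $\prec$ a comparability ordering of $D$. If $(x,y),(x',y')\in Z_D$ satisfy $(x,y)\Gamma^*(x',y')$, then $x\prec y$ if and only if $x'\prec y'$.
   Context: A digraph $D=(V,A)$ is finite, without loops or multiple arcs; write $uv\in A$ for an arc. A comparability ordering of $D$ is a linear ordering $\prec$ of $V$ such that for all $x\prec y\prec z$: $xy,yz\in A$ implies $xz\in A$, and $zy,yx\in A$ implies $zx\in A$; $D$ is a comparability digraph if it has one. Let $Z_D=\{(x,y): xy\in A\text{ or }yx\in A\}$. For $(x,y),(x',y')\in Z_D$ write $(x,y)\Gamma(x',y')$ if one of the following holds: (i) $x=x'$ and $y=y'$; (ii) $x=x'$, $y\ne y'$, and either ($yx,x'y'\in A$ and $yy'\notin A$) or ($y'x',xy\in A$ and $y'y\notin A$); (iii) $y=y'$, $x\ne x'$, and either ($xy,y'x'\in A$ and $xx'\notin A$) or ($x'y',yx\in A$ and $x'x\notin A$). $\Gamma^*$ is the transitive closure of $\Gamma$. -}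

module Defs where

open import Data.Nat using (ℕ)
open import Data.Fin using (Fin)
open import Data.Product using (_×_; _,_)
open import Data.Sum using (_⊎_)
open import Relation.Nullary using (¬_)
open import Relation.Binary.PropositionalEquality using (_≡_; _≢_)
open import Relation.Binary.Structures using (IsStrictTotalOrder)
open import Relation.Binary.Construct.Closure.Transitive using (TransClosure)

-- A finite digraph on vertex set Fin n: an arc relation with no loops.
-- (Multiple arcs cannot occur since arcs are given by a relation.)
record Digraph : Set₁ where
  field
    n     : ℕ
    Arc   : Fin n → Fin n → Set
    noLoop : ∀ x → ¬ Arc x x

module _ (D : Digraph) where
  open Digraph D

  V : Set
  V = Fin n

  record IsComparabilityOrdering (_≺_ : V → V → Set) : Set where
    field
      linear : IsStrictTotalOrder _≡_ _≺_
      trans-fwd : ∀ {x y z} → x ≺ y → y ≺ z → Arc x y → Arc y z → Arc x z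
      trans-bwd : ∀ {x y z} → x ≺ y → y ≺ z → Arc z y → Arc y x → Arc z x

  Z : V × V → Set
  Z (x , y) = Arc x y ⊎ Arc y x

  data ΓRel : V × V → V × V → Set where
    Γ-refl : ∀ {x y} → Z (x , y) → ΓRel (x , y) (x , y)
    Γ-fst₁ : ∀ {x y y'} → Z (x , y) → Z (x , y') → y ≢ y' →
             Arc y x → Arc x y' → ¬ Arc y y' → ΓRel (x , y) (x , y')
    Γ-fst₂ : ∀ {x y y'} → Z (x , y) → Z (x , y') → y ≢ y' →
             Arc y' x → Arc x y → ¬ Arc y' y → ΓRel (x , y) (x , y')
    Γ-snd₁ : ∀ {x x' y} → Z (x , y) → Z (x' , y) → x ≢ x' →
             Arc x y → Arc y x' → ¬ Arc x x' → ΓRel (x , y) (x' , y)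
    Γ-snd₂ : ∀ {x x' y} → Z (x , y) → Z (x' , y) → x ≢ x' →
             Arc x' y → Arc y x → ¬ Arc x' x → ΓRel (x , y) (x' , y)

  Γ* : V × V → V × V → Set
  Γ* = TransClosure ΓRel

-- A single Γ-step replaces (x , y) by (x , y') along a path y → x → y' (or the reverse
-- path) whose ends are not joined by the corresponding arc. If x preceded exactly one of
-- y, y', then x would lie between them in ≺ and the comparability condition would create
-- that arc. Steps that fix the second coordinate are the same argument for the reversed
-- ordering, which is again a comparability ordering; Γ* is handled by induction on paths.
module Submission where

open import Defs
open import Data.Empty using (⊥-elim)
open import Data.Product using (_×_; _,_)
open import Function.Base using (flip)
open import Function.Bundles using (_⇔_; mk⇔)
import Function.Properties.Equivalence as ⇔
open import Level using (Level)
open import Relation.Binary.Core using (Rel)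
open import Relation.Binary.Construct.Closure.Transitive using (TransClosure; [_]; _∷_)
import Relation.Binary.Construct.Flip.EqAndOrd as Flip
open import Relation.Binary.Definitions using (tri<; tri≈; tri>)
open import Relation.Binary.PropositionalEquality using (_≡_; _≢_; refl)
open import Relation.Binary.Structures using (IsStrictTotalOrder)
open import Relation.Nullary using (¬_)

private
  variable
    a ℓ p : Level
    A : Set a

≯∧≢⇒< : {_<_ : Rel A ℓ} → IsStrictTotalOrder _≡_ _<_ →
        ∀ {x y} → ¬ (y < x) → x ≢ y → x < y
≯∧≢⇒< sto {x} {y} y≮x x≢y with IsStrictTotalOrder.compare sto x y
... | tri< x<y _   _   = x<y
... | tri≈ _   x≡y _   = ⊥-elim (x≢y x≡y)
... | tri> _   _   y<x = ⊥-elim (y≮x y<x)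

TransClosure-preserves-⇔ : {R : Rel A ℓ} (P : A → Set p) →
                           (∀ {x y} → R x y → P x ⇔ P y) →
                           ∀ {x y} → TransClosure R x y → P x ⇔ P y
TransClosure-preserves-⇔ P R⇒⇔ [ xRy ]      = R⇒⇔ xRy
TransClosure-preserves-⇔ P R⇒⇔ (xRy ∷ yR⁺z) =
  ⇔.trans (R⇒⇔ xRy) (TransClosure-preserves-⇔ P R⇒⇔ yR⁺z)

module _ (D : Digraph) where
  open Digraph D

  flip-isComparabilityOrdering : ∀ {_≺_ : V D → V D → Set} →
                                 IsComparabilityOrdering D _≺_ →
                                 IsComparabilityOrdering D (flip _≺_)
  flip-isComparabilityOrdering C = record
    { linear    = Flip.isStrictTotalOrder linear
    ; trans-fwd = λ x≻y y≻z → trans-bwd y≻z x≻y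
    ; trans-bwd = λ x≻y y≻z → trans-fwd y≻z x≻y
    }
    where open IsComparabilityOrdering C

  ≺-pivot : ∀ {_≺_ : V D → V D → Set} → IsComparabilityOrdering D _≺_ →
            ∀ {x y y'} → Arc y x → Arc x y' → ¬ Arc y y' → (x ≺ y) ⇔ (x ≺ y')
  ≺-pivot {_≺_} C {x} {y} {y'} yx xy' ¬yy' = mk⇔ to from
    where
    open IsComparabilityOrdering C

    to : x ≺ y → x ≺ y'
    to x≺y = ≯∧≢⇒< linear (λ y'≺x → ¬yy' (trans-bwd y'≺x x≺y yx xy'))
                          (λ { refl → noLoop x xy' })

    from : x ≺ y' → x ≺ y
    from x≺y' = ≯∧≢⇒< linear (λ y≺x → ¬yy' (trans-fwd y≺x x≺y' yx xy'))
                             (λ { refl → noLoop x yx })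

  module _ {_≺_ : V D → V D → Set} (C : IsComparabilityOrdering D _≺_) where

    Forward : V D × V D → Set
    Forward (x , y) = x ≺ y

    Γ-preserves-Forward : ∀ {p q} → ΓRel D p q → Forward p ⇔ Forward q
    Γ-preserves-Forward (Γ-refl _)                = ⇔.refl
    Γ-preserves-Forward (Γ-fst₁ _ _ _ yx xy' ¬yy') = ≺-pivot C yx xy' ¬yy'
    Γ-preserves-Forward (Γ-fst₂ _ _ _ y'x xy ¬y'y) = ⇔.sym (≺-pivot C y'x xy ¬y'y)
    Γ-preserves-Forward (Γ-snd₁ _ _ _ xy yx' ¬xx') =
      ≺-pivot (flip-isComparabilityOrdering C) xy yx' ¬xx'
    Γ-preserves-Forward (Γ-snd₂ _ _ _ x'y yx ¬x'x) =
      ⇔.sym (≺-pivot (flip-isComparabilityOrdering C) x'y yx ¬x'x)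

mainTheorem10 : (D : Digraph) (_≺_ : V D → V D → Set) →
                IsComparabilityOrdering D _≺_ →
                ∀ {x y x' y'} → Z D (x , y) → Z D (x' , y') →
                Γ* D (x , y) (x' , y') →
                (x ≺ y) ⇔ (x' ≺ y')
mainTheorem10 D _≺_ C _ _ =
  TransClosure-preserves-⇔ (Forward D C) (Γ-preserves-Forward D C)
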